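{- Consider the greedy algorithm for interval scheduling on two machines run on a finite collection $S$ of intervals. Every greedy state $\{I_1,I_2\}$ of this execution is of one of the following three forms: (a) $I_1\prec I_2$, $I_1$ and $I_2$ are compatible, and $I_2$ is active; (b) $I_1$ ends earlier than $I_2$, $I_1$ and $I_2$ overlap, and $I_2$ is active; (c) an active interval $I_1$ is fully contained inside the (inactive) interval $I_2$.
   Context: Intervals are pairs $(s,f)$ of reals with $s<f$, with pairwise distinct endpoints; two intervals are compatible if disjoint and overlap otherwise; $J\prec J'$ iff $J$ ends earlier than $J'$. An interval of $S$ is active if no other interval of $S$ is contained in it, and inactive otherwise. The greedy algorithm on two machines considers intervals in increasing order of end time; a considered interval is rejected if no machine is free at its start, otherwise accepted and assigned to the free machine that was busy until the latest time. A greedy state is the multiset of the two intervals last scheduled on the two machines at some time of the execution.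
   Formalization: The endpoints of the intervals in $S$ are rational instead of real. -}

module Defs where

open import Data.Bool using (Bool; true; false; if_then_else_)
open import Data.Maybe using (Maybe; just; nothing)
open import Data.Product using (_×_; _,_)
open import Data.Sum using (_⊎_)
open import Data.List using (List; []; _∷_; concatMap)
open import Data.List.Membership.Propositional using (_∈_)
open import Data.List.Relation.Unary.AllPairs using (AllPairs)
open import Data.Rational using (ℚ; _<_)
open import Data.Rational.Properties using (_<?_)
open import Relation.Nullary using (¬_)
open import Relation.Nullary.Decidable using (⌊_⌋)
open import Relation.Binary.PropositionalEquality using (_≡_; _≢_)

record Interval : Set where
  constructor ⟦_,_⟧⟨_⟩
  field
    s   : ℚ
    f   : ℚ
    s<f : s < f
open Interval public

_≺_ : Interval → Interval → Set
I ≺ J = f I < f J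

Compatible : Interval → Interval → Set
Compatible I J = (f I < s J) ⊎ (f J < s I)

Overlap : Interval → Interval → Set
Overlap I J = ¬ Compatible I J

_⊂_ : Interval → Interval → Set
I ⊂ J = (s J < s I) × (f I < f J)

endpoints : List Interval → List ℚ
endpoints = concatMap (λ I → s I ∷ f I ∷ [])

DistinctEndpoints : List Interval → Set
DistinctEndpoints S = AllPairs _≢_ (endpoints S)

Active : List Interval → Interval → Set
Active S I = ∀ J → J ∈ S → ¬ (J ⊂ I)

Inactive : List Interval → Interval → Set
Inactive S I = ¬ Active S I

-- Greedy on two machines.  A slot holds the last interval scheduled on a
-- machine (nothing = machine never used yet).
Slot : Set
Slot = Maybe Interval

State : Set
State = Slot × Slot

freeAt : Slot → ℚ → Bool
freeAt nothing  t = true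
freeAt (just J) t = ⌊ f J <? t ⌋

-- first slot busy until strictly later than second (unused = -∞)
laterThan : Slot → Slot → Bool
laterThan nothing  _        = false
laterThan (just a) nothing  = true
laterThan (just a) (just b) = ⌊ f b <? f a ⌋

step : State → Interval → State
step (m₁ , m₂) I with freeAt m₁ (s I) | freeAt m₂ (s I)
... | true  | true  = if laterThan m₂ m₁ then (m₁ , just I) else (just I , m₂)
... | true  | false = (just I , m₂)
... | false | true  = (m₁ , just I)
... | false | false = (m₁ , m₂)

states : State → List Interval → List State
states σ []      = σ ∷ []
states σ (I ∷ L) = σ ∷ states (step σ I) L

initial : State
initial = (nothing , nothing)

SortedByEnd : List Interval → Set
SortedByEnd L = AllPairs _≺_ L

Form : List Interval → Interval → Interval → Set
Form S I₁ I₂ =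
    (I₁ ≺ I₂ × Compatible I₁ I₂ × Active S I₂)
  ⊎ (I₁ ≺ I₂ × Overlap I₁ I₂ × Active S I₂)
  ⊎ (Active S I₁ × I₁ ⊂ I₂ × Inactive S I₂)

{-# OPTIONS --safe #-}
-- Run the greedy algorithm while recording the fate of every interval J of S considered so
-- far: either J went to a machine, and then it is that machine's last interval or ended before
-- that interval started, or J was rejected, and then the last intervals of both machines still
-- run at the start of J.  When B is assigned to a machine that is free at s B while the other
-- machine holds Y, then Y ≺ B.  Every J ∈ S with J ⊂ B was considered before B and starts
-- after s B, hence after the free machine's last interval ended; so J can only be Y or end
-- before Y starts.  Thus if B is inactive then Y ⊂ B, and any K ⊂ Y would satisfy K ⊂ B and
-- hence be Y or end before Y starts, which is absurd: Y is active.
module Submission where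

open import Defs
open import Data.Bool using (true; false)
open import Data.Empty using (⊥-elim)
open import Data.List using (List; []; _∷_)
open import Data.List.Membership.Propositional using (_∈_; find; lose)
open import Data.List.Relation.Binary.Permutation.Propositional using (_↭_; ↭-sym)
open import Data.List.Relation.Binary.Permutation.Propositional.Properties using (∈-resp-↭)
open import Data.List.Relation.Unary.All as All using (All; _∷_)
open import Data.List.Relation.Unary.AllPairs as AllPairs using (AllPairs)
open import Data.List.Relation.Unary.Any using (here; there; any?)
open import Data.Maybe using (just; nothing)
open import Data.Maybe.Relation.Unary.All as MaybeAll using (just; nothing)
open import Data.Maybe.Relation.Unary.Any as MaybeAny using (just)
open import Data.Product using (_×_; _,_; proj₁; proj₂; ∃)
open import Data.Rational using (ℚ; _<_; _≤_)
open import Data.Rational.Properties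
  using (_<?_; <-irrefl; <-asym; <-trans; <⇒≤; ≮⇒≥; ≤-refl; ≤-<-trans; module ≤-Reasoning)
open import Data.Sum using (_⊎_; inj₁; inj₂)
import Data.Sum as Sum
open import Data.Unit using (⊤; tt)
open import Function using (_∘_)
open import Relation.Nullary using (¬_; Dec; yes; no)
open import Relation.Nullary.Decidable using (_×-dec_; _⊎-dec_)
open import Relation.Binary.PropositionalEquality using (_≡_; refl)

private
  variable
    B I J K X Y : Interval
    m m₁ m₂ : Slot
    σ : State
    R : List Interval

_⊴_ : Interval → Interval → Set
J ⊴ X = J ≡ X ⊎ f J < s X

⊴⇒f≤ : J ⊴ X → f J ≤ f X
⊴⇒f≤ (inj₁ refl) = ≤-refl
⊴⇒f≤ {J} {X} (inj₂ fJ<sX) = <⇒≤ (<-trans fJ<sX (s<f X))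

⊴⇒s≤ : J ⊴ X → s J ≤ s X
⊴⇒s≤ (inj₁ refl) = ≤-refl
⊴⇒s≤ {J} (inj₂ fJ<sX) = <⇒≤ (<-trans (s<f J) fJ<sX)

⊂-irrefl : ¬ I ⊂ I
⊂-irrefl (sI<sI , _) = <-irrefl refl sI<sI

⊂-trans : I ⊂ J → J ⊂ K → I ⊂ K
⊂-trans (sJ<sI , fI<fJ) (sK<sJ , fJ<fK) = <-trans sK<sJ sJ<sI , <-trans fI<fJ fJ<fK

⊂⇒⋬ : K ⊂ Y → ¬ K ⊴ Y
⊂⇒⋬ {K} K⊂Y (inj₁ refl) = ⊂-irrefl {K} K⊂Y
⊂⇒⋬ {K} (sY<sK , _) (inj₂ fK<sY) = <-asym fK<sY (<-trans sY<sK (s<f K))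

⊴-⊂⇒⊂ : J ⊂ B → J ⊴ Y → Y ≺ B → Y ⊂ B
⊴-⊂⇒⊂ {J} {B} {Y} (sB<sJ , _) J⊴Y Y≺B = (begin-strict s B <⟨ sB<sJ ⟩ s J ≤⟨ ⊴⇒s≤ J⊴Y ⟩ s Y ∎) , Y≺B
  where open ≤-Reasoning

_⊂?_ : ∀ I J → Dec (I ⊂ J)
I ⊂? J = (s J <? s I) ×-dec (f I <? f J)

compatible? : ∀ I J → Dec (Compatible I J)
compatible? I J = (f I <? s J) ⊎-dec (f J <? s I)

FreeAt : Slot → ℚ → Set
FreeAt m t = MaybeAll.All (λ X → f X < t) m

BusyAt : Slot → ℚ → Set
BusyAt m t = MaybeAny.Any (λ X → t ≤ f X) m

freeAt-true : ∀ m t → freeAt m t ≡ true → FreeAt m t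
freeAt-true nothing  t _ = nothing
freeAt-true (just X) t _ with f X <? t
freeAt-true (just X) t _  | yes fX<t = just fX<t
freeAt-true (just X) t () | no  _

freeAt-false : ∀ m t → freeAt m t ≡ false → BusyAt m t
freeAt-false nothing  t ()
freeAt-false (just X) t _ with f X <? t
freeAt-false (just X) t () | yes _
freeAt-false (just X) t _  | no  fX≮t = just (≮⇒≥ fX≮t)

data StepView (m₁ m₂ : Slot) (I : Interval) : State → Set where
  reject  : BusyAt m₁ (s I) → BusyAt m₂ (s I) → StepView m₁ m₂ I (m₁ , m₂)
  assign₁ : FreeAt m₁ (s I) → StepView m₁ m₂ I (just I , m₂)
  assign₂ : FreeAt m₂ (s I) → StepView m₁ m₂ I (m₁ , just I)

step-view : ∀ m₁ m₂ I → StepView m₁ m₂ I (step (m₁ , m₂) I)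
step-view m₁ m₂ I with freeAt m₁ (s I) in free₁ | freeAt m₂ (s I) in free₂
... | true  | true with laterThan m₂ m₁
...   | true  = assign₂ (freeAt-true m₂ (s I) free₂)
...   | false = assign₁ (freeAt-true m₁ (s I) free₁)
step-view m₁ m₂ I | true  | false = assign₁ (freeAt-true m₁ (s I) free₁)
step-view m₁ m₂ I | false | true  = assign₂ (freeAt-true m₂ (s I) free₂)
step-view m₁ m₂ I | false | false =
  reject (freeAt-false m₁ (s I) free₁) (freeAt-false m₂ (s I) free₂)

states-invariant : (P : State → List Interval → Set) →
                   (∀ {σ B R} → P σ (B ∷ R) → P (step σ B) R) →
                   ∀ {σ σ′ R} → P σ R → σ′ ∈ states σ R → ∃ (P σ′)
states-invariant P preserve {R = []}    p (here refl) = [] , p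
states-invariant P preserve {R = B ∷ R} p (here refl) = B ∷ R , p
states-invariant P preserve {R = B ∷ R} p (there σ′∈) = states-invariant P preserve (preserve p) σ′∈

data Settled (J : Interval) : State → Set where
  on₁      : MaybeAny.Any (J ⊴_) m₁ → Settled J (m₁ , m₂)
  on₂      : MaybeAny.Any (J ⊴_) m₂ → Settled J (m₁ , m₂)
  rejected : BusyAt m₁ (s J) → BusyAt m₂ (s J) → Settled J (m₁ , m₂)

Settled-swap : Settled J (m₁ , m₂) → Settled J (m₂ , m₁)
Settled-swap (on₁ J⊴m₁)             = on₂ J⊴m₁
Settled-swap (on₂ J⊴m₂)             = on₁ J⊴m₂
Settled-swap (rejected busy₁ busy₂) = rejected busy₂ busy₁

Settled-assign : FreeAt m₁ (s B) → Settled J (m₁ , m₂) → Settled J (just B , m₂)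
Settled-assign (just fX<sB) (on₁ (just J⊴X)) = on₁ (just (inj₂ (≤-<-trans (⊴⇒f≤ J⊴X) fX<sB)))
Settled-assign _            (on₂ J⊴m₂)       = on₂ J⊴m₂
Settled-assign {B = B} (just fX<sB) (rejected (just sJ≤fX) busy₂) =
  rejected (just (<⇒≤ (begin-strict _ ≤⟨ sJ≤fX ⟩ _ <⟨ fX<sB ⟩ s B <⟨ s<f B ⟩ f B ∎))) busy₂
  where open ≤-Reasoning

Settled⇒⊴ : FreeAt m (s B) → s B < s J → Settled J (m , just Y) → J ⊴ Y
Settled⇒⊴ {J = J} (just fX<sB) sB<sJ (on₁ (just J⊴X)) = ⊥-elim (<-irrefl refl
  (begin-strict f J ≤⟨ ⊴⇒f≤ J⊴X ⟩ _ <⟨ fX<sB ⟩ _ <⟨ sB<sJ ⟩ s J <⟨ s<f J ⟩ f J ∎))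
  where open ≤-Reasoning
Settled⇒⊴ _ _ (on₂ (just J⊴Y)) = J⊴Y
Settled⇒⊴ {J = J} (just fX<sB) sB<sJ (rejected (just sJ≤fX) _) = ⊥-elim (<-irrefl refl
  (begin-strict s J ≤⟨ sJ≤fX ⟩ _ <⟨ fX<sB ⟩ _ <⟨ sB<sJ ⟩ s J ∎))
  where open ≤-Reasoning

module _ (S : List Interval) where

  Accounted : State → List Interval → Set
  Accounted σ R = ∀ {J} → J ∈ S → J ∈ R ⊎ Settled J σ

  Good : State → Set
  Good (just I₁ , just I₂) = Form S I₁ I₂ ⊎ Form S I₂ I₁
  Good _ = ⊤

  Good-swap : Good (m₁ , m₂) → Good (m₂ , m₁)
  Good-swap {just _}  {just _}  = Sum.swap
  Good-swap {just _}  {nothing} = λ _ → tt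
  Good-swap {nothing} {just _}  = λ _ → tt
  Good-swap {nothing} {nothing} = λ _ → tt

  Active⇒Form : Y ≺ B → Active S B → Form S Y B
  Active⇒Form {Y} {B} Y≺B B-active with compatible? Y B
  ... | yes compat  = inj₁ (Y≺B , compat , B-active)
  ... | no  ¬compat = inj₂ (inj₁ (Y≺B , ¬compat , B-active))

  contained⇒⊴ : FreeAt m (s B) → All (B ≺_) R → Accounted (m , just Y) (B ∷ R) →
                J ∈ S → J ⊂ B → J ⊴ Y
  contained⇒⊴ {B = B} {J = J} free B≺R accounted J∈S J⊂B with accounted J∈S
  ... | inj₁ (here refl)  = ⊥-elim (⊂-irrefl {B} J⊂B)
  ... | inj₁ (there J∈R)  = ⊥-elim (<-asym (All.lookup B≺R J∈R) (proj₂ J⊂B))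
  ... | inj₂ J-settled    = Settled⇒⊴ {B = B} {J} free (proj₁ J⊂B) J-settled

  Form-assign : FreeAt m (s B) → Y ≺ B → All (B ≺_) R → Accounted (m , just Y) (B ∷ R) →
                Form S Y B
  Form-assign {B = B} {Y = Y} free Y≺B B≺R accounted with any? (_⊂? B) S
  ... | no ∄J⊂B = Active⇒Form {Y = Y} {B = B} Y≺B (λ J J∈S J⊂B → ∄J⊂B (lose J∈S J⊂B))
  ... | yes ∃J⊂B with find ∃J⊂B
  ...   | J , J∈S , J⊂B = inj₂ (inj₂ (Y-active , Y⊂B , λ B-active → B-active J J∈S J⊂B))
    where
    Y⊂B : Y ⊂ B
    Y⊂B = ⊴-⊂⇒⊂ {B = B} J⊂B (contained⇒⊴ free B≺R accounted J∈S J⊂B) Y≺B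
    Y-active : Active S Y
    Y-active K K∈S K⊂Y =
      ⊂⇒⋬ K⊂Y (contained⇒⊴ free B≺R accounted K∈S (⊂-trans {K} {Y} {B} K⊂Y Y⊂B))

  record Invariant (σ : State) (R : List Interval) : Set where
    field
      sorted    : AllPairs _≺_ R
      accounted : Accounted σ R
      earlier₁  : MaybeAll.All (λ X → All (X ≺_) R) (proj₁ σ)
      earlier₂  : MaybeAll.All (λ X → All (X ≺_) R) (proj₂ σ)
      good      : Good σ

  Invariant-swap : Invariant (m₁ , m₂) R → Invariant (m₂ , m₁) R
  Invariant-swap inv = record
    { sorted    = sorted
    ; accounted = Sum.map₂ Settled-swap ∘ accounted
    ; earlier₁  = earlier₂
    ; earlier₂  = earlier₁
    ; good      = Good-swap good
    }
    where open Invariant inv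

  reject-preserves : BusyAt m₁ (s B) → BusyAt m₂ (s B) →
                     Invariant (m₁ , m₂) (B ∷ R) → Invariant (m₁ , m₂) R
  reject-preserves {m₁} {B = B} {m₂} {R} busy₁ busy₂ inv = record
    { sorted    = AllPairs.tail sorted
    ; accounted = account ∘ accounted
    ; earlier₁  = MaybeAll.map All.tail earlier₁
    ; earlier₂  = MaybeAll.map All.tail earlier₂
    ; good      = good
    }
    where
    open Invariant inv
    account : J ∈ B ∷ R ⊎ Settled J (m₁ , m₂) → J ∈ R ⊎ Settled J (m₁ , m₂)
    account (inj₁ (here refl)) = inj₂ (rejected busy₁ busy₂)
    account (inj₁ (there J∈R)) = inj₁ J∈R
    account (inj₂ J-settled)   = inj₂ J-settled

  assign-preserves : FreeAt m₁ (s B) → Invariant (m₁ , m₂) (B ∷ R) → Invariant (just B , m₂) R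
  assign-preserves {m₁} {B} {m₂} {R} free inv = record
    { sorted    = AllPairs.tail sorted
    ; accounted = account ∘ accounted
    ; earlier₁  = just (AllPairs.head sorted)
    ; earlier₂  = MaybeAll.map All.tail earlier₂
    ; good      = good′ m₂ earlier₂ accounted
    }
    where
    open Invariant inv
    account : J ∈ B ∷ R ⊎ Settled J (m₁ , m₂) → J ∈ R ⊎ Settled J (just B , m₂)
    account (inj₁ (here refl)) = inj₂ (on₁ (just (inj₁ refl)))
    account (inj₁ (there J∈R)) = inj₁ J∈R
    account (inj₂ J-settled)   = inj₂ (Settled-assign free J-settled)
    good′ : ∀ m → MaybeAll.All (λ X → All (X ≺_) (B ∷ R)) m → Accounted (m₁ , m) (B ∷ R) →
            Good (just B , m)
    good′ nothing  _                  _         = tt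
    good′ (just Y) (just (Y≺B ∷ _)) accounted =
      inj₂ (Form-assign free Y≺B (AllPairs.head sorted) accounted)

  step-preserves : Invariant σ (B ∷ R) → Invariant (step σ B) R
  step-preserves {m₁ , m₂} {B} inv with step (m₁ , m₂) B | step-view m₁ m₂ B
  ... | _ | reject busy₁ busy₂ = reject-preserves busy₁ busy₂ inv
  ... | _ | assign₁ free       = assign-preserves free inv
  ... | _ | assign₂ free       = Invariant-swap (assign-preserves free (Invariant-swap inv))

lemma19 : (S L : List Interval) → DistinctEndpoints S → L ↭ S → SortedByEnd L →
          (I₁ I₂ : Interval) → (just I₁ , just I₂) ∈ states initial L →
          Form S I₁ I₂ ⊎ Form S I₂ I₁
lemma19 S L _ L↭S sorted I₁ I₂ I₁I₂∈states =
  Invariant.good (proj₂ (states-invariant (Invariant S) (step-preserves S)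
                                           initial-invariant I₁I₂∈states))
  where
  initial-invariant : Invariant S initial L
  initial-invariant = record
    { sorted    = sorted
    ; accounted = inj₁ ∘ ∈-resp-↭ (↭-sym L↭S)
    ; earlier₁  = nothing
    ; earlier₂  = nothing
    ; good      = tt
    }
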